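{- Let $R$ be a finite commutative local ring with nonzero identity and characteristic $2$. Then the involutory Cayley graph $\Gamma(R)$ is connected and $4$-regular if and only if $R \cong \mathbb{Z}_2[x,y]/\langle x^2, xy, y^2\rangle$.
   Context: The involutory Cayley graph $\Gamma(R)$ of a ring $R$ is the simple undirected graph with vertex set $R$ in which distinct $x,y$ are adjacent if and only if $(x-y)^2 = 1$. -}

module Defs where

open import Level using (Level; _⊔_; suc)
open import Data.Bool using (Bool; true; false; _∧_; _xor_)
open import Data.Product using (Σ; ∃; _×_; _,_)
open import Data.Fin using (Fin)
open import Data.Nat using (ℕ)
open import Data.Sum using (_⊎_)
open import Relation.Nullary using (¬_)
open import Relation.Unary using (Pred; _⊆_; _∈_)
open import Relation.Binary.PropositionalEquality as ≡ using (_≡_)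
open import Relation.Binary.Construct.Closure.ReflexiveTransitive using (Star)
open import Function.Bundles using (Inverse)
open import Algebra.Bundles using (CommutativeRing; RawRing)

Finite : ∀ {c ℓ} → CommutativeRing c ℓ → Set (c ⊔ ℓ)
Finite R = ∃ λ n → Inverse (CommutativeRing.setoid R) (≡.setoid (Fin n))

module _ {c ℓ} (R : CommutativeRing c ℓ) where
  open CommutativeRing R

  record IsIdeal (I : Pred Carrier (c ⊔ ℓ)) : Set (c ⊔ ℓ) where
    field
      resp  : ∀ {x y} → x ≈ y → x ∈ I → y ∈ I
      zero∈ : 0# ∈ I
      +-closed : ∀ {x y} → x ∈ I → y ∈ I → (x + y) ∈ I
      *-closed : ∀ r {x} → x ∈ I → (r * x) ∈ I

  record IsMaximalIdeal (M : Pred Carrier (c ⊔ ℓ)) : Set (suc (c ⊔ ℓ)) where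
    field
      isIdeal : IsIdeal M
      proper  : ¬ (1# ∈ M)
      maximal : ∀ (J : Pred Carrier (c ⊔ ℓ)) → IsIdeal J → M ⊆ J →
                J ⊆ M ⊎ (1# ∈ J)

  IsLocal : Set (suc (c ⊔ ℓ))
  IsLocal = Σ (Pred Carrier (c ⊔ ℓ)) λ M → IsMaximalIdeal M ×
              (∀ N → IsMaximalIdeal N → (N ⊆ M) × (M ⊆ N))

  Adj : Carrier → Carrier → Set ℓ
  Adj x y = ¬ (x ≈ y) × ((x - y) * (x - y) ≈ 1#)

  Connected : Set (c ⊔ ℓ)
  Connected = ∀ x y → Star Adj x y

  Regular : (k : ℕ) → Set (c ⊔ ℓ)
  Regular k = ∀ x → Σ (Fin k → Carrier) λ f →
                (∀ i j → f i ≈ f j → i ≡ j) ×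
                (∀ i → Adj x (f i)) ×
                (∀ y → Adj x y → ∃ λ i → f i ≈ y)

-- The ring Z₂[x,y]/⟨x², xy, y²⟩, presented on its Z₂-basis {1, x, y}:
-- the triple (a , b , c) stands for a + b·x + c·y  (a, b, c ∈ Z₂ = Bool).
-- Addition is componentwise (xor); multiplication uses x² = xy = y² = 0:
-- (a + b x + c y)(a' + b' x + c' y) = aa' + (ab' + ba') x + (ac' + ca') y.

Z₂[x,y]/⟨x²,xy,y²⟩ : RawRing Level.zero Level.zero
Z₂[x,y]/⟨x²,xy,y²⟩ = record
  { Carrier = Bool × Bool × Bool
  ; _≈_ = _≡_
  ; _+_ = λ { (a , b , c) (a′ , b′ , c′) → (a xor a′ , b xor b′ , c xor c′) }
  ; _*_ = λ { (a , b , c) (a′ , b′ , c′) →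
               (a ∧ a′ , (a ∧ b′) xor (b ∧ a′) , (a ∧ c′) xor (c ∧ a′)) }
  ; -_ = λ v → v
  ; 0# = (false , false , false)
  ; 1# = (true , false , false)
  }

{-# OPTIONS --safe #-}

-- In characteristic 2, (x - y)² = 1 iff (1 + x + y)² = 0, so the neighbours of x in Γ(R) are
-- the elements x + 1 + m with m² = 0. Hence Γ(R) is k-regular iff R has exactly k square-zero
-- elements, and the vertices reachable from 0 are sums of 1 and square-zero elements.
-- Four square-zero elements form an additive group {0, X, Y, X + Y}; XY squares to zero, so it
-- lies in that group, which forces XY = 0. Then a + bx + cy ↦ a + bX + cY is an injective ring
-- map from Z₂[x,y]/⟨x², xy, y²⟩ to R, and connectivity makes it onto. Conversely, that ring has
-- the four square-zero elements bx + cy, and each element is one of them or 1 plus one of them.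

module Submission where

open import Defs
open import Data.Product using (_×_; ∃)
open import Relation.Nullary using (¬_)
open import Function.Bundles using (_⇔_)
open import Algebra.Bundles using (CommutativeRing)
open import Algebra.Morphism.Structures using (module RingMorphisms)

open import Level using (_⊔_)
open import Algebra.Bundles using (RawRing; Ring)
open import Data.Bool using (Bool; true; false; _∧_; _xor_)
open import Data.Empty using (⊥-elim)
open import Data.Fin using (Fin; zero; suc)
open import Data.Fin.Permutation as Permutation using (Permutation′; transpose; _⟨$⟩ʳ_; _⟨$⟩ˡ_)
open import Data.Nat using (ℕ)
open import Data.Product using (Σ; ∃₂; _,_; proj₁; proj₂)
open import Data.Sum using (_⊎_; inj₁; inj₂)
open import Function.Base using (_∘_)
open import Function.Bundles using (Inverse; Injection; Equivalence; mk⇔)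
open import Function.Properties.Inverse using (Inverse⇒Injection)
open import Function.Properties.Bijection using (Bijection⇒Inverse)
open import Function.Construct.Symmetry using () renaming (inverse to inverse-sym)
open import Relation.Binary.Bundles using (Setoid)
open import Relation.Binary.Definitions using (Reflexive)
open import Relation.Binary.PropositionalEquality as ≡ using (_≡_)
open import Relation.Unary using (Pred)
open import Relation.Binary.Construct.Closure.ReflexiveTransitive using (Star; ε; _◅_; _◅◅_; reverse)

module _ {a ℓ} (S : Setoid a ℓ) where
  open Setoid S

  Enumeration : ∀ {p} → ℕ → Pred Carrier p → Set (a ⊔ ℓ ⊔ p)
  Enumeration k P = Σ (Fin k → Carrier) λ f →
    (∀ i j → f i ≈ f j → i ≡ j) × (∀ i → P (f i)) × (∀ y → P y → ∃ λ i → f i ≈ y)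

  module _ {p} {P : Pred Carrier p} where

    enumeration-permute : ∀ {k} → Permutation′ k → Enumeration k P → Enumeration k P
    enumeration-permute π (f , f-injective , f∈P , f-complete) =
      f ∘ (π ⟨$⟩ʳ_) , injective , (λ i → f∈P (π ⟨$⟩ʳ i)) , complete
      where
      injective : ∀ i j → f (π ⟨$⟩ʳ i) ≈ f (π ⟨$⟩ʳ j) → i ≡ j
      injective i j = Injection.injective (Inverse⇒Injection π) ∘ f-injective _ _

      complete : ∀ y → P y → ∃ λ i → f (π ⟨$⟩ʳ i) ≈ y
      complete y Py = let i , fi≈y = f-complete y Py
                      in π ⟨$⟩ˡ i , trans (reflexive (≡.cong f (Permutation.inverseʳ π))) fi≈y

    enumeration-starting-at : ∀ {k z} → P z → Enumeration (ℕ.suc k) P →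
                              Σ (Enumeration (ℕ.suc k) P) λ e → proj₁ e zero ≈ z
    enumeration-starting-at Pz e@(_ , _ , _ , f-complete) =
      let i , fi≈z = f-complete _ Pz in enumeration-permute (transpose zero i) e , fi≈z

enumeration-transport : ∀ {a₁ ℓ₁ a₂ ℓ₂ p q k} {S₁ : Setoid a₁ ℓ₁} {S₂ : Setoid a₂ ℓ₂}
  {P : Pred (Setoid.Carrier S₁) p} {Q : Pred (Setoid.Carrier S₂) q} →
  (ι : Inverse S₁ S₂) → (∀ {x} → P x → Q (Inverse.to ι x)) → (∀ {y} → Q y → P (Inverse.from ι y)) →
  Enumeration S₁ k P → Enumeration S₂ k Q
enumeration-transport ι P⇒Q Q⇒P (f , f-injective , f∈P , f-complete) =
  to ∘ f ,
  (λ i j e → f-injective i j (Injection.injective (Inverse⇒Injection ι) e)) ,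
  (λ i → P⇒Q (f∈P i)) ,
  λ y Qy → let i , fi≈y = f-complete _ (Q⇒P Qy) in i , inverseˡ fi≈y
  where open Inverse ι

open RawRing Z₂[x,y]/⟨x²,xy,y²⟩ using ()
  renaming (Carrier to T; _+_ to _+ᵀ_; _*_ to _*ᵀ_; 0# to 0ᵀ; 1# to 1ᵀ)

SquareZeroᵀ : Pred T _
SquareZeroᵀ t = t *ᵀ t ≡ 0ᵀ

xor≡false⇒≡ : ∀ {a b} → a xor b ≡ false → a ≡ b
xor≡false⇒≡ {false} {false} _ = ≡.refl
xor≡false⇒≡ {true}  {true}  _ = ≡.refl

+ᵀ≡0ᵀ⇒≡ : ∀ {s t} → s +ᵀ t ≡ 0ᵀ → s ≡ t
+ᵀ≡0ᵀ⇒≡ {a , b , c} {a′ , b′ , c′} s+t≡0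
  with xor≡false⇒≡ {a} {a′} (≡.cong proj₁ s+t≡0)
     | xor≡false⇒≡ {b} {b′} (≡.cong (proj₁ ∘ proj₂) s+t≡0)
     | xor≡false⇒≡ {c} {c′} (≡.cong (proj₂ ∘ proj₂) s+t≡0)
... | ≡.refl | ≡.refl | ≡.refl = ≡.refl

nilpotentᵀ-squareZero : ∀ b c → SquareZeroᵀ (false , b , c)
nilpotentᵀ-squareZero false false = ≡.refl
nilpotentᵀ-squareZero false true  = ≡.refl
nilpotentᵀ-squareZero true  false = ≡.refl
nilpotentᵀ-squareZero true  true  = ≡.refl

squareZeroᵀ⊎unipotentᵀ : ∀ t → SquareZeroᵀ t ⊎ SquareZeroᵀ (1ᵀ +ᵀ t)
squareZeroᵀ⊎unipotentᵀ (false , b , c) = inj₁ (nilpotentᵀ-squareZero b c)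
squareZeroᵀ⊎unipotentᵀ (true  , b , c) = inj₂ (nilpotentᵀ-squareZero b c)

squareZeroᵀ-enumeration : Enumeration (≡.setoid T) 4 SquareZeroᵀ
squareZeroᵀ-enumeration = nilpotent , injective , member , complete
  where
  nilpotent : Fin 4 → T
  nilpotent zero                   = false , false , false
  nilpotent (suc zero)             = false , true  , false
  nilpotent (suc (suc zero))       = false , false , true
  nilpotent (suc (suc (suc zero))) = false , true  , true

  index : T → Fin 4
  index (_ , false , false) = zero
  index (_ , true  , false) = suc zero
  index (_ , false , true)  = suc (suc zero)
  index (_ , true  , true)  = suc (suc (suc zero))

  index-nilpotent : ∀ i → index (nilpotent i) ≡ i
  index-nilpotent zero                   = ≡.refl
  index-nilpotent (suc zero)             = ≡.refl
  index-nilpotent (suc (suc zero))       = ≡.refl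
  index-nilpotent (suc (suc (suc zero))) = ≡.refl

  injective : ∀ i j → nilpotent i ≡ nilpotent j → i ≡ j
  injective i j e = ≡.trans (≡.sym (index-nilpotent i)) (≡.trans (≡.cong index e) (index-nilpotent j))

  member : ∀ i → SquareZeroᵀ (nilpotent i)
  member zero                   = ≡.refl
  member (suc zero)             = ≡.refl
  member (suc (suc zero))       = ≡.refl
  member (suc (suc (suc zero))) = ≡.refl

  complete : ∀ t → SquareZeroᵀ t → ∃ λ i → nilpotent i ≡ t
  complete (false , false , false) _ = zero , ≡.refl
  complete (false , true  , false) _ = suc zero , ≡.refl
  complete (false , false , true)  _ = suc (suc zero) , ≡.refl
  complete (false , true  , true)  _ = suc (suc (suc zero)) , ≡.refl
  complete (true  , _     , _)     ()

module _ {a ℓ₁ c ℓ} (S : RawRing a ℓ₁) (R : Ring c ℓ) where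
  open RingMorphisms S (Ring.rawRing R) using (IsRingIsomorphism)
  open RingMorphisms (Ring.rawRing R) S using () renaming (IsRingIsomorphism to IsRingIsomorphism⁻¹)
  open RawRing S using () renaming (_≈_ to _≈ˢ_)
  open Ring R
  open import Relation.Binary.Reasoning.Setoid setoid

  inverse-isRingIsomorphism : Reflexive _≈ˢ_ → ∀ {ψ} → IsRingIsomorphism ψ → ∃ λ φ → IsRingIsomorphism⁻¹ φ
  inverse-isRingIsomorphism ≈ˢ-refl {ψ} iso = φ , record
    { isRingMonomorphism = record
      { isRingHomomorphism = record
        { isSemiringHomomorphism = record
          { isNearSemiringHomomorphism = record
            { +-isMonoidHomomorphism = record
              { isMagmaHomomorphism = record
                { isRelHomomorphism = record { cong = φ-cong }
                ; homo = λ x y → φ-unique (trans (+-homo (φ x) (φ y)) (+-cong (ψφ x) (ψφ y)))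
                }
              ; ε-homo = φ-unique 0#-homo
              }
            ; *-homo = λ x y → φ-unique (trans (*-homo (φ x) (φ y)) (*-cong (ψφ x) (ψφ y)))
            }
          ; 1#-homo = φ-unique 1#-homo
          }
        ; -‿homo = λ x → φ-unique (trans (-‿homo (φ x)) (-‿cong (ψφ x)))
        }
      ; injective = λ {x} {y} φx≈φy → trans (sym (ψφ x)) (trans (⟦⟧-cong φx≈φy) (ψφ y))
      }
    ; surjective = λ s → ψ s , λ x≈ψs → φ-unique (sym x≈ψs)
    }
    where
    open IsRingIsomorphism iso

    φ : Carrier → RawRing.Carrier S
    φ x = proj₁ (surjective x)

    ψφ : ∀ x → ψ (φ x) ≈ x
    ψφ x = proj₂ (surjective x) ≈ˢ-refl

    φ-unique : ∀ {x t} → ψ t ≈ x → φ x ≈ˢ t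
    φ-unique ψt≈x = injective (trans (ψφ _) (sym ψt≈x))

    φ-cong : ∀ {x y} → x ≈ y → φ x ≈ˢ φ y
    φ-cong {y = y} x≈y = φ-unique (trans (ψφ y) (sym x≈y))

HasCharacteristic2 : ∀ {c ℓ} → CommutativeRing c ℓ → Set ℓ
HasCharacteristic2 R = 1# + 1# ≈ 0#
  where open CommutativeRing R

module Characteristic2 {c ℓ} (R : CommutativeRing c ℓ) (char2 : HasCharacteristic2 R) where
  open CommutativeRing R hiding (zero)
  open import Algebra.Properties.Group +-group using (inverseˡ-unique; inverseʳ-unique)
  open import Relation.Binary.Reasoning.Setoid setoid
  open import Algebra.Solver.Ring.NaturalCoefficients.Default commutativeSemiring
    using (solve; _:+_; _:*_; _:=_)

  SquareZero : Pred Carrier ℓ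
  SquareZero m = m * m ≈ 0#

  x+x≈0 : ∀ x → x + x ≈ 0#
  x+x≈0 x = begin
    x + x            ≈⟨ +-cong (*-identityʳ x) (*-identityʳ x) ⟨
    x * 1# + x * 1#  ≈⟨ distribˡ x 1# 1# ⟨
    x * (1# + 1#)    ≈⟨ *-congˡ char2 ⟩
    x * 0#           ≈⟨ zeroʳ x ⟩
    0#               ∎

  -x≈x : ∀ x → - x ≈ x
  -x≈x x = sym (inverseʳ-unique x x (x+x≈0 x))

  x+y≈0⇒x≈y : ∀ {x y} → x + y ≈ 0# → x ≈ y
  x+y≈0⇒x≈y {x} {y} x+y≈0 = trans (inverseˡ-unique x y x+y≈0) (-x≈x y)

  x+[x+y]≈y : ∀ x y → x + (x + y) ≈ y
  x+[x+y]≈y x y = begin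
    x + (x + y)  ≈⟨ +-assoc x x y ⟨
    (x + x) + y  ≈⟨ +-congʳ (x+x≈0 x) ⟩
    0# + y       ≈⟨ +-identityˡ y ⟩
    y            ∎

  x≈x+y⇒y≈0 : ∀ {x y} → x ≈ x + y → y ≈ 0#
  x≈x+y⇒y≈0 {x} {y} x≈x+y = begin
    y            ≈⟨ x+[x+y]≈y x y ⟨
    x + (x + y)  ≈⟨ +-congˡ x≈x+y ⟨
    x + x        ≈⟨ x+x≈0 x ⟩
    0#           ∎

  [x-y]²≈[x+y]² : ∀ x y → (x - y) * (x - y) ≈ (x + y) * (x + y)
  [x-y]²≈[x+y]² x y = *-cong x-y≈x+y x-y≈x+y
    where x-y≈x+y = +-congˡ (-x≈x y)

  square-+ : ∀ x y → (x + y) * (x + y) ≈ x * x + y * y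
  square-+ x y = begin
    (x + y) * (x + y)                    ≈⟨ expand x y ⟩
    (x * x + y * y) + (x * y + x * y)    ≈⟨ +-congˡ (x+x≈0 (x * y)) ⟩
    (x * x + y * y) + 0#                 ≈⟨ +-identityʳ _ ⟩
    x * x + y * y                        ∎
    where
    expand : ∀ x y → (x + y) * (x + y) ≈ (x * x + y * y) + (x * y + x * y)
    expand = solve 2 (λ x y → (x :+ y) :* (x :+ y) := (x :* x :+ y :* y) :+ (x :* y :+ x :* y)) refl

  square-1+ : ∀ x → (1# + x) * (1# + x) ≈ 1# + x * x
  square-1+ x = trans (square-+ 1# x) (+-congʳ (*-identityˡ 1#))

  squareZero-resp : ∀ {x y} → x ≈ y → SquareZero x → SquareZero y
  squareZero-resp x≈y = trans (*-cong (sym x≈y) (sym x≈y))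

  squareZero-+ : ∀ {x y} → SquareZero x → SquareZero y → SquareZero (x + y)
  squareZero-+ {x} {y} x²≈0 y²≈0 = begin
    (x + y) * (x + y)  ≈⟨ square-+ x y ⟩
    x * x + y * y      ≈⟨ +-cong x²≈0 y²≈0 ⟩
    0# + 0#            ≈⟨ +-identityˡ 0# ⟩
    0#                 ∎

  bit : Bool → Carrier
  bit false = 0#
  bit true  = 1#

  bit-xor : ∀ a b → bit (a xor b) ≈ bit a + bit b
  bit-xor false b     = sym (+-identityˡ (bit b))
  bit-xor true  false = sym (+-identityʳ 1#)
  bit-xor true  true  = sym char2

  bit-∧ : ∀ a b → bit (a ∧ b) ≈ bit a * bit b
  bit-∧ false b = sym (zeroˡ (bit b))
  bit-∧ true  b = sym (*-identityˡ (bit b))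

  shift : Carrier → Carrier → Carrier
  shift x y = 1# + (x + y)

  shift-involutive : ∀ x y → shift x (shift x y) ≈ y
  shift-involutive x y = begin
    1# + (x + (1# + (x + y)))  ≈⟨ +-congˡ (exchange x 1# (x + y)) ⟩
    1# + (1# + (x + (x + y)))  ≈⟨ x+[x+y]≈y 1# _ ⟩
    x + (x + y)                ≈⟨ x+[x+y]≈y x y ⟩
    y                          ∎
    where
    exchange : ∀ x y z → x + (y + z) ≈ y + (x + z)
    exchange = solve 3 (λ x y z → x :+ (y :+ z) := y :+ (x :+ z)) refl

  shift-inverse : Carrier → Inverse setoid setoid
  shift-inverse x = record
    { to        = shift x
    ; from      = shift x
    ; to-cong   = shift-cong
    ; from-cong = shift-cong
    ; inverse   = shift-cancel , shift-cancel
    }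
    where
    shift-cong : ∀ {y z} → y ≈ z → shift x y ≈ shift x z
    shift-cong = +-congˡ ∘ +-congˡ

    shift-cancel : ∀ {y z} → z ≈ shift x y → shift x z ≈ y
    shift-cancel {y} z≈ = trans (shift-cong z≈) (shift-involutive x y)

  module _ (1≉0 : ¬ 1# ≈ 0#) where

    1+squareZero≉0 : ∀ {m} → SquareZero m → ¬ 1# + m ≈ 0#
    1+squareZero≉0 {m} m²≈0 1+m≈0 = 1≉0 (begin
      1#       ≈⟨ *-identityˡ 1# ⟨
      1# * 1#  ≈⟨ *-cong 1≈m 1≈m ⟩
      m * m    ≈⟨ m²≈0 ⟩
      0#       ∎)
      where 1≈m = x+y≈0⇒x≈y 1+m≈0

    adj⇒squareZero : ∀ {x y} → Adj R x y → SquareZero (shift x y)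
    adj⇒squareZero {x} {y} (_ , [x-y]²≈1) = begin
      (1# + (x + y)) * (1# + (x + y))  ≈⟨ square-1+ (x + y) ⟩
      1# + (x + y) * (x + y)           ≈⟨ +-congˡ (trans (sym ([x-y]²≈[x+y]² x y)) [x-y]²≈1) ⟩
      1# + 1#                          ≈⟨ char2 ⟩
      0#                               ∎

    squareZero⇒adj : ∀ {x y} → SquareZero (shift x y) → Adj R x y
    squareZero⇒adj {x} {y} s²≈0 = x≉y , (begin
      (x - y) * (x - y)  ≈⟨ [x-y]²≈[x+y]² x y ⟩
      (x + y) * (x + y)  ≈⟨ x+y≈0⇒x≈y (trans (sym (square-1+ (x + y))) s²≈0) ⟨
      1#                 ∎)
      where
      x≉y : ¬ x ≈ y
      x≉y x≈y = 1+squareZero≉0 s²≈0 (begin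
        1# + (1# + (x + y))  ≈⟨ x+[x+y]≈y 1# (x + y) ⟩
        x + y                ≈⟨ +-congˡ x≈y ⟨
        x + x                ≈⟨ x+x≈0 x ⟩
        0#                   ∎)

    adj-sym : ∀ {x y} → Adj R x y → Adj R y x
    adj-sym {x} {y} = squareZero⇒adj ∘ squareZero-resp (+-congˡ (+-comm x y)) ∘ adj⇒squareZero

    adj-shift : ∀ {x m} → SquareZero m → Adj R x (shift x m)
    adj-shift {x} {m} = squareZero⇒adj ∘ squareZero-resp (sym (shift-involutive x m))

    -- Regular R k x unfolds to Enumeration setoid k (Adj R x).
    regular⇔enumeration : ∀ {k} → Regular R k ⇔ Enumeration setoid k SquareZero
    regular⇔enumeration = mk⇔
      (λ regular → enumeration-transport (shift-inverse 0#) adj⇒squareZero adj-shift (regular 0#))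
      (λ enum x → enumeration-transport (shift-inverse x) adj-shift adj⇒squareZero enum)

    connected : (∀ x → SquareZero x ⊎ SquareZero (1# + x)) → Connected R
    connected squareZero⊎unipotent x y = reverse adj-sym (path-from-0 x) ◅◅ path-from-0 y
      where
      path-from-0 : ∀ x → Star (Adj R) 0# x
      path-from-0 x with squareZero⊎unipotent x
      ... | inj₂ [1+x]²≈0 = squareZero⇒adj (squareZero-resp (+-congˡ (sym (+-identityˡ x))) [1+x]²≈0) ◅ ε
      ... | inj₁ x²≈0     = squareZero⇒adj (squareZero-resp x≈ x²≈0)
                          ◅ squareZero⇒adj (squareZero-resp 0≈ (zeroˡ 0#))
                          ◅ ε
        where
        x≈ : x ≈ shift 0# (1# + x)
        x≈ = sym (trans (+-congˡ (+-identityˡ _)) (x+[x+y]≈y 1# x))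

        0≈ : 0# ≈ shift (1# + x) x
        0≈ = sym (begin
          1# + ((1# + x) + x)  ≈⟨ +-congˡ (+-assoc 1# x x) ⟩
          1# + (1# + (x + x))  ≈⟨ x+[x+y]≈y 1# (x + x) ⟩
          x + x                ≈⟨ x+x≈0 x ⟩
          0#                   ∎)

    module Embedding (X Y : Carrier) where

      embed : T → Carrier
      embed (a , b , c) = bit a + (bit b * X + bit c * Y)

      embed-+ : ∀ s t → embed (s +ᵀ t) ≈ embed s + embed t
      embed-+ (a , b , c) (a′ , b′ , c′) = begin
        bit (a xor a′) + (bit (b xor b′) * X + bit (c xor c′) * Y)
          ≈⟨ +-cong (bit-xor a a′) (+-cong (*-congʳ (bit-xor b b′)) (*-congʳ (bit-xor c c′))) ⟩
        (bit a + bit a′) + ((bit b + bit b′) * X + (bit c + bit c′) * Y)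
          ≈⟨ regroup (bit a) (bit a′) (bit b) (bit b′) (bit c) (bit c′) X Y ⟩
        embed (a , b , c) + embed (a′ , b′ , c′)
          ∎
        where
        regroup : ∀ a a′ b b′ c c′ x y →
                  (a + a′) + ((b + b′) * x + (c + c′) * y) ≈ (a + (b * x + c * y)) + (a′ + (b′ * x + c′ * y))
        regroup = solve 8 (λ a a′ b b′ c c′ x y →
          (a :+ a′) :+ ((b :+ b′) :* x :+ (c :+ c′) :* y) := (a :+ (b :* x :+ c :* y)) :+ (a′ :+ (b′ :* x :+ c′ :* y))) refl

      embed-0 : embed 0ᵀ ≈ 0#
      embed-0 = trans (+-identityˡ _) (trans (+-cong (zeroˡ X) (zeroˡ Y)) (+-identityˡ 0#))

      embed-1 : embed 1ᵀ ≈ 1#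
      embed-1 = trans (+-congˡ (trans (+-cong (zeroˡ X) (zeroˡ Y)) (+-identityˡ 0#))) (+-identityʳ 1#)

      embed-X : embed (false , true , false) ≈ X
      embed-X = trans (+-identityˡ _) (trans (+-cong (*-identityˡ X) (zeroˡ Y)) (+-identityʳ X))

      embed-Y : embed (false , false , true) ≈ Y
      embed-Y = trans (+-identityˡ _) (trans (+-cong (zeroˡ X) (*-identityˡ Y)) (+-identityˡ Y))

      embed-X+Y : embed (false , true , true) ≈ X + Y
      embed-X+Y = trans (+-identityˡ _) (+-cong (*-identityˡ X) (*-identityˡ Y))

      record IsSquareZeroBasis : Set (c ⊔ ℓ) where
        field
          X²≈0  : SquareZero X
          Y²≈0  : SquareZero Y
          X≉0   : ¬ X ≈ 0#
          Y≉0   : ¬ Y ≈ 0#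
          X≉Y   : ¬ X ≈ Y
          spans : ∀ m → SquareZero m → ∃₂ λ b c → embed (false , b , c) ≈ m

      module _ (basis : IsSquareZeroBasis) where
        open IsSquareZeroBasis basis

        embed-nilpotent-*X : ∀ b c → X * embed (false , b , c) ≈ bit c * (X * Y)
        embed-nilpotent-*X b c = begin
          X * (0# + (bit b * X + bit c * Y))  ≈⟨ *-congˡ (+-identityˡ _) ⟩
          X * (bit b * X + bit c * Y)         ≈⟨ expand (bit b) (bit c) X Y ⟩
          bit b * (X * X) + bit c * (X * Y)   ≈⟨ +-congʳ (trans (*-congˡ X²≈0) (zeroʳ (bit b))) ⟩
          0# + bit c * (X * Y)                ≈⟨ +-identityˡ _ ⟩
          bit c * (X * Y)                     ∎
          where
          expand : ∀ b c x y → x * (b * x + c * y) ≈ b * (x * x) + c * (x * y)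
          expand = solve 4 (λ b c x y → x :* (b :* x :+ c :* y) := b :* (x :* x) :+ c :* (x :* y)) refl

        embed-nilpotent-*Y : ∀ b c → Y * embed (false , b , c) ≈ bit b * (X * Y)
        embed-nilpotent-*Y b c = begin
          Y * (0# + (bit b * X + bit c * Y))  ≈⟨ *-congˡ (+-identityˡ _) ⟩
          Y * (bit b * X + bit c * Y)         ≈⟨ expand (bit b) (bit c) X Y ⟩
          bit b * (X * Y) + bit c * (Y * Y)   ≈⟨ +-congˡ (trans (*-congˡ Y²≈0) (zeroʳ (bit c))) ⟩
          bit b * (X * Y) + 0#                ≈⟨ +-identityʳ _ ⟩
          bit b * (X * Y)                     ∎
          where
          expand : ∀ b c x y → y * (b * x + c * y) ≈ b * (x * y) + c * (y * y)
          expand = solve 4 (λ b c x y → y :* (b :* x :+ c :* y) := b :* (x :* y) :+ c :* (y :* y)) refl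

        X*XY≈0 : X * (X * Y) ≈ 0#
        X*XY≈0 = begin
          X * (X * Y)  ≈⟨ *-assoc X X Y ⟨
          (X * X) * Y  ≈⟨ *-congʳ X²≈0 ⟩
          0# * Y       ≈⟨ zeroˡ Y ⟩
          0#           ∎

        Y*XY≈0 : Y * (X * Y) ≈ 0#
        Y*XY≈0 = begin
          Y * (X * Y)  ≈⟨ reassociate X Y ⟩
          X * (Y * Y)  ≈⟨ *-congˡ Y²≈0 ⟩
          X * 0#       ≈⟨ zeroʳ X ⟩
          0#           ∎
          where
          reassociate : ∀ x y → y * (x * y) ≈ x * (y * y)
          reassociate = solve 2 (λ x y → y :* (x :* y) := x :* (y :* y)) refl

        XY²≈0 : SquareZero (X * Y)
        XY²≈0 = begin
          (X * Y) * (X * Y)  ≈⟨ *-assoc X Y (X * Y) ⟩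
          X * (Y * (X * Y))  ≈⟨ *-congˡ Y*XY≈0 ⟩
          X * 0#             ≈⟨ zeroʳ X ⟩
          0#                 ∎

        -- XY = bX + cY for some bits b, c; multiplying by Y gives b·XY = Y·XY = 0, by X gives c·XY = 0.
        XY≈0 : X * Y ≈ 0#
        XY≈0 with spans (X * Y) XY²≈0
        ... | true  , c     , e = begin
          X * Y                          ≈⟨ *-identityˡ (X * Y) ⟨
          1# * (X * Y)                   ≈⟨ embed-nilpotent-*Y true c ⟨
          Y * embed (false , true , c)   ≈⟨ *-congˡ e ⟩
          Y * (X * Y)                    ≈⟨ Y*XY≈0 ⟩
          0#                             ∎
        ... | false , true  , e = begin
          X * Y                          ≈⟨ *-identityˡ (X * Y) ⟨
          1# * (X * Y)                   ≈⟨ embed-nilpotent-*X false true ⟨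
          X * embed (false , false , true) ≈⟨ *-congˡ e ⟩
          X * (X * Y)                    ≈⟨ X*XY≈0 ⟩
          0#                             ∎
        ... | false , false , e = trans (sym e) embed-0

        embed-* : ∀ s t → embed (s *ᵀ t) ≈ embed s * embed t
        embed-* (a , b , c) (a′ , b′ , c′) = begin
          bit (a ∧ a′) + (bit ((a ∧ b′) xor (b ∧ a′)) * X + bit ((a ∧ c′) xor (c ∧ a′)) * Y)
            ≈⟨ +-cong (bit-∧ a a′) (+-cong (*-congʳ (bit-∧-xor-∧ a b′ b a′)) (*-congʳ (bit-∧-xor-∧ a c′ c a′))) ⟩
          A * A′ + ((A * B′ + B * A′) * X + (A * C′ + C * A′) * Y)
            ≈⟨ +-identityʳ _ ⟨
          (A * A′ + ((A * B′ + B * A′) * X + (A * C′ + C * A′) * Y)) + 0#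
            ≈⟨ +-congˡ quadratic-part≈0 ⟨
          (A * A′ + ((A * B′ + B * A′) * X + (A * C′ + C * A′) * Y)) +
            ((B * B′) * (X * X) + ((B * C′ + C * B′) * (X * Y) + (C * C′) * (Y * Y)))
            ≈⟨ expand A A′ B B′ C C′ X Y ⟨
          (A + (B * X + C * Y)) * (A′ + (B′ * X + C′ * Y))
            ∎
          where
          A = bit a ; B = bit b ; C = bit c ; A′ = bit a′ ; B′ = bit b′ ; C′ = bit c′

          bit-∧-xor-∧ : ∀ p q r s → bit ((p ∧ q) xor (r ∧ s)) ≈ bit p * bit q + bit r * bit s
          bit-∧-xor-∧ p q r s = trans (bit-xor (p ∧ q) (r ∧ s)) (+-cong (bit-∧ p q) (bit-∧ r s))

          quadratic-part≈0 : (B * B′) * (X * X) + ((B * C′ + C * B′) * (X * Y) + (C * C′) * (Y * Y)) ≈ 0#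
          quadratic-part≈0 = begin
            (B * B′) * (X * X) + ((B * C′ + C * B′) * (X * Y) + (C * C′) * (Y * Y))
              ≈⟨ +-cong (*-congˡ X²≈0) (+-cong (*-congˡ XY≈0) (*-congˡ Y²≈0)) ⟩
            (B * B′) * 0# + ((B * C′ + C * B′) * 0# + (C * C′) * 0#)
              ≈⟨ +-cong (zeroʳ _) (+-cong (zeroʳ _) (zeroʳ _)) ⟩
            0# + (0# + 0#)
              ≈⟨ trans (+-identityˡ _) (+-identityˡ 0#) ⟩
            0#
              ∎

          expand : ∀ a a′ b b′ c c′ x y →
            (a + (b * x + c * y)) * (a′ + (b′ * x + c′ * y)) ≈
            (a * a′ + ((a * b′ + b * a′) * x + (a * c′ + c * a′) * y)) +
            ((b * b′) * (x * x) + ((b * c′ + c * b′) * (x * y) + (c * c′) * (y * y)))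
          expand = solve 8 (λ a a′ b b′ c c′ x y →
            (a :+ (b :* x :+ c :* y)) :* (a′ :+ (b′ :* x :+ c′ :* y)) :=
            (a :* a′ :+ ((a :* b′ :+ b :* a′) :* x :+ (a :* c′ :+ c :* a′) :* y)) :+
            ((b :* b′) :* (x :* x) :+ ((b :* c′ :+ c :* b′) :* (x :* y) :+ (c :* c′) :* (y :* y)))) refl

        embed-squareZero : ∀ {t} → SquareZeroᵀ t → SquareZero (embed t)
        embed-squareZero {t} t²≡0 = trans (sym (embed-* t t)) (trans (reflexive (≡.cong embed t²≡0)) embed-0)

        embed-kernel : ∀ t → embed t ≈ 0# → t ≡ 0ᵀ
        embed-kernel (true  , b     , c)     e = ⊥-elim (1+squareZero≉0 nilpotent²≈0 e)
          where
          nilpotent²≈0 : SquareZero (bit b * X + bit c * Y)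
          nilpotent²≈0 = squareZero-resp (+-identityˡ _) (embed-squareZero {false , b , c} (nilpotentᵀ-squareZero b c))
        embed-kernel (false , false , false) _ = ≡.refl
        embed-kernel (false , true  , false) e = ⊥-elim (X≉0 (trans (sym embed-X) e))
        embed-kernel (false , false , true)  e = ⊥-elim (Y≉0 (trans (sym embed-Y) e))
        embed-kernel (false , true  , true)  e = ⊥-elim (X≉Y (x+y≈0⇒x≈y (trans (sym embed-X+Y) e)))

        embed-injective : ∀ {s t} → embed s ≈ embed t → s ≡ t
        embed-injective {s} {t} es≈et = +ᵀ≡0ᵀ⇒≡ (embed-kernel (s +ᵀ t) (begin
          embed (s +ᵀ t)       ≈⟨ embed-+ s t ⟩
          embed s + embed t    ≈⟨ +-congʳ es≈et ⟩
          embed t + embed t    ≈⟨ x+x≈0 (embed t) ⟩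
          0#                   ∎))

        Image : Pred Carrier ℓ
        Image y = ∃ λ t → embed t ≈ y

        image-adj-closed : ∀ {x y} → Adj R x y → Image x → Image y
        image-adj-closed {x} {y} adj (t , et≈x) =
          let b , c , em≈m = spans (shift x y) (adj⇒squareZero adj)
          in 1ᵀ +ᵀ (t +ᵀ (false , b , c)) , (begin
            embed (1ᵀ +ᵀ (t +ᵀ (false , b , c)))        ≈⟨ embed-+ 1ᵀ (t +ᵀ (false , b , c)) ⟩
            embed 1ᵀ + embed (t +ᵀ (false , b , c))     ≈⟨ +-cong embed-1 (embed-+ t (false , b , c)) ⟩
            1# + (embed t + embed (false , b , c))      ≈⟨ +-congˡ (+-cong et≈x em≈m) ⟩
            shift x (shift x y)                         ≈⟨ shift-involutive x y ⟩
            y                                           ∎)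

        embed-surjective : Connected R → ∀ y → Image y
        embed-surjective conn y = along (conn 0# y) (0ᵀ , embed-0)
          where
          along : ∀ {x y} → Star (Adj R) x y → Image x → Image y
          along ε            = λ image → image
          along (adj ◅ path) = along path ∘ image-adj-closed adj

        embed-isRingIsomorphism : Connected R → RingMorphisms.IsRingIsomorphism Z₂[x,y]/⟨x²,xy,y²⟩ rawRing embed
        embed-isRingIsomorphism conn = record
          { isRingMonomorphism = record
            { isRingHomomorphism = record
              { isSemiringHomomorphism = record
                { isNearSemiringHomomorphism = record
                  { +-isMonoidHomomorphism = record
                    { isMagmaHomomorphism = record
                      { isRelHomomorphism = record { cong = λ { ≡.refl → refl } }
                      ; homo = embed-+
                      }
                    ; ε-homo = embed-0
                    }
                  ; *-homo = embed-*
                  }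
                ; 1#-homo = embed-1
                }
              ; -‿homo = λ t → sym (-x≈x (embed t))
              }
            ; injective = embed-injective
            }
          ; surjective = λ y → let t , et≈y = embed-surjective conn y in t , λ { ≡.refl → et≈y }
          }

    squareZeroBasis : Enumeration setoid 4 SquareZero → ∃₂ λ X Y → Embedding.IsSquareZeroBasis X Y
    squareZeroBasis enum with enumeration-starting-at setoid (zeroˡ 0#) enum
    ... | (n , n-injective , n∈N , n-complete) , n₀≈0 = X , Y , record
      { X²≈0  = n∈N (suc zero)
      ; Y²≈0  = n∈N (suc (suc zero))
      ; X≉0   = X≉0
      ; Y≉0   = Y≉0
      ; X≉Y   = distinct (λ ())
      ; spans = spans
      }
      where
      X = n (suc zero)
      Y = n (suc (suc zero))
      open Embedding X Y using (embed; embed-0; embed-X; embed-Y; embed-X+Y)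

      distinct : ∀ {i j} → ¬ i ≡ j → ¬ n i ≈ n j
      distinct i≢j = i≢j ∘ n-injective _ _

      X≉0 : ¬ X ≈ 0#
      X≉0 X≈0 = distinct (λ ()) (trans X≈0 (sym n₀≈0))

      Y≉0 : ¬ Y ≈ 0#
      Y≉0 Y≈0 = distinct (λ ()) (trans Y≈0 (sym n₀≈0))

      n₃≈X+Y : n (suc (suc (suc zero))) ≈ X + Y
      n₃≈X+Y with n-complete (X + Y) (squareZero-+ (n∈N (suc zero)) (n∈N (suc (suc zero))))
      ... | zero                   , n₀≈X+Y = ⊥-elim (distinct (λ ()) (x+y≈0⇒x≈y (trans (sym n₀≈X+Y) n₀≈0)))
      ... | suc zero               , X≈X+Y  = ⊥-elim (Y≉0 (x≈x+y⇒y≈0 X≈X+Y))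
      ... | suc (suc zero)         , Y≈X+Y  = ⊥-elim (X≉0 (x≈x+y⇒y≈0 (trans Y≈X+Y (+-comm X Y))))
      ... | suc (suc (suc zero))   , n₃≈X+Y = n₃≈X+Y

      spans : ∀ m → SquareZero m → ∃₂ λ b c → embed (false , b , c) ≈ m
      spans m m²≈0 with n-complete m m²≈0
      ... | zero                 , n₀≈m = false , false , trans embed-0 (trans (sym n₀≈0) n₀≈m)
      ... | suc zero             , X≈m  = true  , false , trans embed-X X≈m
      ... | suc (suc zero)       , Y≈m  = false , true  , trans embed-Y Y≈m
      ... | suc (suc (suc zero)) , n₃≈m = true  , true  , trans embed-X+Y (trans (sym n₃≈X+Y) n₃≈m)

    connected×regular⇒isomorphic : Connected R → Regular R 4 →
                                   ∃ λ φ → RingMorphisms.IsRingIsomorphism rawRing Z₂[x,y]/⟨x²,xy,y²⟩ φ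
    connected×regular⇒isomorphic conn reg =
      let X , Y , basis = squareZeroBasis (Equivalence.to regular⇔enumeration reg)
      in inverse-isRingIsomorphism Z₂[x,y]/⟨x²,xy,y²⟩ ring ≡.refl (Embedding.embed-isRingIsomorphism X Y basis conn)

    module _ {φ : Carrier → T} (iso : RingMorphisms.IsRingIsomorphism rawRing Z₂[x,y]/⟨x²,xy,y²⟩ φ) where
      open RingMorphisms.IsRingIsomorphism iso

      φ-squareZero : ∀ {x} → SquareZero x ⇔ SquareZeroᵀ (φ x)
      φ-squareZero {x} = mk⇔
        (λ x²≈0 → ≡.trans (≡.sym (*-homo x x)) (≡.trans (⟦⟧-cong x²≈0) 0#-homo))
        (λ φx²≡0 → injective (≡.trans (*-homo x x) (≡.trans φx²≡0 (≡.sym 0#-homo))))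

      isomorphic⇒squareZero⊎unipotent : ∀ x → SquareZero x ⊎ SquareZero (1# + x)
      isomorphic⇒squareZero⊎unipotent x with squareZeroᵀ⊎unipotentᵀ (φ x)
      ... | inj₁ φx²≡0       = inj₁ (Equivalence.from φ-squareZero φx²≡0)
      ... | inj₂ [1+φx]²≡0 = inj₂ (Equivalence.from φ-squareZero (≡.subst SquareZeroᵀ (≡.sym φ[1+x]≡1+φx) [1+φx]²≡0))
        where
        φ[1+x]≡1+φx : φ (1# + x) ≡ 1ᵀ +ᵀ φ x
        φ[1+x]≡1+φx = ≡.trans (+-homo 1# x) (≡.cong (_+ᵀ φ x) 1#-homo)

      isomorphic⇒enumeration : Enumeration setoid 4 SquareZero
      isomorphic⇒enumeration = enumeration-transport (inverse-sym φ-inverse)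
        (λ {t} t²≡0 → Equivalence.from φ-squareZero (≡.subst SquareZeroᵀ (≡.sym (Inverse.strictlyInverseˡ φ-inverse t)) t²≡0))
        (Equivalence.to φ-squareZero)
        squareZeroᵀ-enumeration
        where
        φ-inverse : Inverse setoid (≡.setoid T)
        φ-inverse = Bijection⇒Inverse record { to = φ ; cong = ⟦⟧-cong ; bijective = injective , surjective }

      isomorphic⇒connected×regular : Connected R × Regular R 4
      isomorphic⇒connected×regular =
        connected isomorphic⇒squareZero⊎unipotent , Equivalence.from regular⇔enumeration isomorphic⇒enumeration

lemma2p6 : ∀ {c ℓ} (R : CommutativeRing c ℓ) →
           Finite R →
           IsLocal R →
           ¬ (CommutativeRing._≈_ R (CommutativeRing.1# R) (CommutativeRing.0# R)) →
           CommutativeRing._≈_ R (CommutativeRing._+_ R (CommutativeRing.1# R) (CommutativeRing.1# R)) (CommutativeRing.0# R) →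
           ((Connected R × Regular R 4) ⇔
            ∃ λ φ → RingMorphisms.IsRingIsomorphism (CommutativeRing.rawRing R) Z₂[x,y]/⟨x²,xy,y²⟩ φ)
lemma2p6 R _ _ 1≉0 char2 = mk⇔
  (λ (conn , reg) → connected×regular⇒isomorphic 1≉0 conn reg)
  (λ (_ , iso) → isomorphic⇒connected×regular 1≉0 iso)
  where open Characteristic2 R char2
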